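{- For every finite set of formulas $\Gamma$ and every formula $\phi$: if $\Gamma\vdash\phi$ (classical consequence), then $\Gamma\Vdash\phi$ (validity in the base-extension semantics).
   Context: Let $\mathbb{C}$ be a denumerable set of contents and $\mathbb{L}=\{c^+,c^-: c\in\mathbb{C}\}$ the literals. Formulas: literals, $\bot$, $\top$, and $\phi\land\psi$, $\phi\lor\psi$, $\phi\to\psi$. Duality: $(c^+)^\bot=c^-$, $(c^-)^\bot=c^+$, $\bot^\bot=\top$, $\top^\bot=\bot$, $(\phi\land\psi)^\bot=\phi^\bot\lor\psi^\bot$, $(\phi\lor\psi)^\bot=\phi^\bot\land\psi^\bot$, $(\phi\to\psi)^\bot=\phi\land\psi^\bot$. Classical consequence: a valuation is $v:\mathbb{L}\to\{0,1\}$ with $v(c^-)=1-v(c^+)$, extended by $v(\bot)=0$, $v(\top)=1$, $\min$ for $\land$, $\max$ for $\lor$, $v(\phi\to\psi)=\max\{1-v(\phi),v(\psi)\}$; $\Gamma\vdash\phi$ iff every valuation giving value $1$ to all members of $\Gamma$ gives $\phi$ value $1$. Bases: an atomic rule is $(L_1\Rightarrow l_1),\ldots,(L_n\Rightarrow l_n)\Rightarrow l$ ($n\ge0$, $l,l_i\in\mathbb{L}$, $L_i\subseteq\mathbb{L}$ finite); a base is a set of atomic rules. Derivability $L\vdash_{\mathcal{B}} l$ ($L\subseteq\mathbb{L}$ finite, $l\in\mathbb{L}\cup\{\bot\}$) is the smallest relation closed under: (REF) $l\in L$ gives $L\vdash_{\mathcal{B}} l$; (APP$_1$) $(\Rightarrow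 l)\in\mathcal{B}$ gives $L\vdash_{\mathcal{B}} l$; (APP$_2$) if $(L_1\Rightarrow l_1),\ldots,(L_n\Rightarrow l_n)\Rightarrow l\in\mathcal{B}$ and $L\cup L_i\vdash_{\mathcal{B}} l_i$ for all $i$ then $L\vdash_{\mathcal{B}} l$; (ABS) $L\vdash_{\mathcal{B}} m$ and $L\vdash_{\mathcal{B}} m^\bot$ give $L\vdash_{\mathcal{B}}\bot$; (DM) $L\cup\{m\}\vdash_{\mathcal{B}}\bot$ gives $L\vdash_{\mathcal{B}} m^\bot$. Support (defined by induction on logical weight): $\Vdash_{\mathcal{B}} l$ iff $\emptyset\vdash_{\mathcal{B}} l$ for $l\in\mathbb{L}$; $\Vdash_{\mathcal{B}}\bot$ iff $\emptyset\vdash_{\mathcal{B}} l$ for all $l\in\mathbb{L}$; $\Vdash_{\mathcal{B}}\top$ always; $\Vdash_{\mathcal{B}}\phi\to\psi$ iff $\{\phi\}\Vdash_{\mathcal{B}}\psi$; $\Vdash_{\mathcal{B}}\phi\land\psi$ iff $\Vdash_{\mathcal{B}}\phi$ and $\Vdash_{\mathcal{B}}\psi$; $\Vdash_{\mathcal{B}}\phi\lor\psi$ iff for all bases $\mathcal{C}\supseteq\mathcal{B}$ and all $l\in\mathbb{L}$, if $\{\phi\}\Vdash_{\mathcal{C}} l$ and $\{\psi\}\Vdash_{\mathcal{C}} l$ then $\Vdash_{\mathcal{C}} l$; for a nonempty finite set $\Delta$, $\Delta\Vdash_{\mathcal{B}}\phi$ iff for all bases $\mathcal{C}\supseteq\mathcal{B}$,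 if $\Vdash_{\mathcal{C}}\delta$ for every $\delta\in\Delta$ then $\Vdash_{\mathcal{C}}\phi$; $\emptyset\Vdash_{\mathcal{B}}\phi$ means $\Vdash_{\mathcal{B}}\phi$. Finally $\Gamma\Vdash\phi$ iff $\Gamma\Vdash_{\mathcal{B}}\phi$ for every base $\mathcal{B}$. -}

module Defs where

open import Level using (Level; Lift; lift) renaming (suc to lsuc; zero to lzero)
open import Data.Nat using (ℕ)
open import Data.Bool using (Bool; true; false; not; _∧_; _∨_)
open import Data.List using (List; []; _∷_; _++_)
open import Data.List.Relation.Unary.All using (All)
open import Data.List.Membership.Propositional using (_∈_)
open import Data.Product using (_×_; _,_)
open import Data.Unit.Polymorphic using (⊤)
open import Relation.Binary.PropositionalEquality using (_≡_)

Content : Set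
Content = ℕ

data Lit : Set where
  pos : Content → Lit
  neg : Content → Lit

dual : Lit → Lit
dual (pos c) = neg c
dual (neg c) = pos c

data Formula : Set where
  lit  : Lit → Formula
  bot  : Formula
  top  : Formula
  _∧ᶠ_ : Formula → Formula → Formula
  _∨ᶠ_ : Formula → Formula → Formula
  _⇒ᶠ_ : Formula → Formula → Formula

_ᵈ : Formula → Formula
lit l ᵈ = lit (dual l)
bot ᵈ = top
top ᵈ = bot
(φ ∧ᶠ ψ) ᵈ = (φ ᵈ) ∨ᶠ (ψ ᵈ)
(φ ∨ᶠ ψ) ᵈ = (φ ᵈ) ∧ᶠ (ψ ᵈ)
(φ ⇒ᶠ ψ) ᵈ = φ ∧ᶠ (ψ ᵈ)

-- A valuation is determined by its values on positive literals;
-- v(c⁻) = 1 - v(c⁺).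
Valuation : Set
Valuation = Content → Bool

evalLit : Valuation → Lit → Bool
evalLit v (pos c) = v c
evalLit v (neg c) = not (v c)

eval : Valuation → Formula → Bool
eval v (lit l) = evalLit v l
eval v bot = false
eval v top = true
eval v (φ ∧ᶠ ψ) = eval v φ ∧ eval v ψ
eval v (φ ∨ᶠ ψ) = eval v φ ∨ eval v ψ
eval v (φ ⇒ᶠ ψ) = not (eval v φ) ∨ eval v ψ

_⊢_ : List Formula → Formula → Set
Γ ⊢ φ = (v : Valuation) → All (λ γ → eval v γ ≡ true) Γ → eval v φ ≡ true

-- Atomic rule (L₁ ⇒ l₁), …, (Lₙ ⇒ lₙ) ⇒ l  (finite sets as lists).
record Rule : Set where
  constructor _⇛_
  field
    premises : List (List Lit × Lit)
    conclusion : Lit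
open Rule public

-- A base is a (possibly infinite) set of atomic rules.
Base : Set₁
Base = Rule → Set

_⊆ᴮ_ : Base → Base → Set
B ⊆ᴮ C = (r : Rule) → B r → C r

data Target : Set where
  tlit : Lit → Target
  tbot : Target

data Derives (B : Base) : List Lit → Target → Set where
  ref  : ∀ {L l} → l ∈ L → Derives B L (tlit l)
  app₁ : ∀ {L l} → B ([] ⇛ l) → Derives B L (tlit l)
  app₂ : ∀ {L ps l} → B (ps ⇛ l) →
         All (λ p → Derives B (L ++ Data.Product.proj₁ p) (tlit (Data.Product.proj₂ p))) ps →
         Derives B L (tlit l)
  abs  : ∀ {L m} → Derives B L (tlit m) → Derives B L (tlit (dual m)) → Derives B L tbot
  dm   : ∀ {L m} → Derives B (m ∷ L) tbot → Derives B L (tlit (dual m))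

Supp : Base → Formula → Set₁
Supp B (lit l) = Lift (lsuc lzero) (Derives B [] (tlit l))
Supp B bot = (l : Lit) → Lift (lsuc lzero) (Derives B [] (tlit l))
Supp B top = ⊤
-- ⊩_B φ → ψ  iff  {φ} ⊩_B ψ
Supp B (φ ⇒ᶠ ψ) = (C : Base) → B ⊆ᴮ C → Supp C φ → Supp C ψ
Supp B (φ ∧ᶠ ψ) = Supp B φ × Supp B ψ
Supp B (φ ∨ᶠ ψ) =
  (C : Base) → B ⊆ᴮ C → (l : Lit) →
  ((D : Base) → C ⊆ᴮ D → Supp D φ → Supp D (lit l)) →
  ((D : Base) → C ⊆ᴮ D → Supp D ψ → Supp D (lit l)) →
  Supp C (lit l)

SuppCtx : Base → List Formula → Formula → Set₁
SuppCtx B [] φ = Supp B φ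
SuppCtx B Δ@(_ ∷ _) φ = (C : Base) → B ⊆ᴮ C → All (Supp C) Δ → Supp C φ

_⊩_ : List Formula → Formula → Set₁
Γ ⊩ φ = (B : Base) → SuppCtx B Γ φ

{-# OPTIONS --safe #-}
-- Support is closed under case distinction on a content c: whatever is
-- supported both in B extended by the axiom c⁺ and in B extended by c⁻ is
-- supported in B. For literals this is a derivation with DM and ABS, and it
-- lifts to all formulas because ∨ and → only quantify over extensions and
-- literal conclusions. So it suffices to support φ in extensions D deciding
-- every content of Γ and φ. Such a D induces a valuation v, and by induction
-- on formulas (as in Kalmár's lemma) D supports every formula true under v and
-- supports ⊥ as soon as it supports a formula false under v. So if D supports
-- Γ, either it supports ⊥ and hence φ, or v satisfies Γ and hence φ, and then
-- D supports φ.
module Submission where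

open import Defs
open import Level using (lift; lower)
open import Function using (id; _∘_; case_of_)
open import Data.Bool using (Bool; true; false; not; _∧_; _∨_)
open import Data.Nat using (_≟_)
open import Data.Product using (_×_; _,_; proj₁; proj₂)
open import Data.Sum using (_⊎_; inj₁; inj₂; [_,_]′)
import Data.Sum as Sum
open import Data.Unit.Polymorphic using (tt)
open import Data.List using (List; []; _∷_; _++_; concatMap)
open import Data.List.Relation.Unary.All as All using (All; []; _∷_)
open import Data.List.Relation.Unary.Any using (here; there)
open import Data.List.Membership.Propositional using (_∈_)
open import Data.List.Membership.DecPropositional _≟_ using (_∈?_)
open import Data.List.Relation.Binary.Subset.Propositional using (_⊆_)
open import Data.List.Relation.Binary.Subset.Propositional.Properties
  using (∷⁺ʳ; ++⁺ˡ; xs⊆xs++ys; xs⊆ys++xs)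
open import Relation.Nullary using (yes; no; contradiction)
open import Relation.Unary using (_∪_; ｛_｝)
open import Relation.Unary.Properties using (⊆′-refl; ⊆′-trans)
open import Relation.Binary.PropositionalEquality using (_≡_; refl; cong; subst)

private
  variable
    B C D E : Base
    L L′ : List Lit
    l m : Lit
    c : Content
    t : Target
    ps : List (List Lit × Lit)
    v : Valuation
    cs cs′ : List Content
    φ ψ : Formula

dual-involutive : ∀ l → dual (dual l) ≡ l
dual-involutive (pos c) = refl
dual-involutive (neg c) = refl

content : Lit → Content
content (pos c) = c
content (neg c) = c

Premises : Base → List Lit → List (List Lit × Lit) → Set
Premises B L = All (λ p → Derives B (L ++ proj₁ p) (tlit (proj₂ p)))

Proves : Base → Lit → Set
Proves B l = Derives B [] (tlit l)

_⊕_ : Base → Lit → Base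
B ⊕ m = B ∪ ｛ [] ⇛ m ｝

⊕-extends : B ⊆ᴮ (B ⊕ m)
⊕-extends _ = inj₁

⊕-mono : B ⊆ᴮ C → (B ⊕ m) ⊆ᴮ (C ⊕ m)
⊕-mono B⊆C r = Sum.map₁ (B⊆C r)

⊕-axiom : Derives (B ⊕ m) L (tlit m)
⊕-axiom = app₁ (inj₂ refl)

mutual
  Derives-mono : B ⊆ᴮ C → Derives B L t → Derives C L t
  Derives-mono B⊆C (ref l∈L)    = ref l∈L
  Derives-mono B⊆C (app₁ r)     = app₁ (B⊆C _ r)
  Derives-mono B⊆C (app₂ r ds)  = app₂ (B⊆C _ r) (Premises-mono B⊆C ds)
  Derives-mono B⊆C (abs d e)    = abs (Derives-mono B⊆C d) (Derives-mono B⊆C e)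
  Derives-mono B⊆C (dm d)       = dm (Derives-mono B⊆C d)

  Premises-mono : B ⊆ᴮ C → Premises B L ps → Premises C L ps
  Premises-mono B⊆C []       = []
  Premises-mono B⊆C (d ∷ ds) = Derives-mono B⊆C d ∷ Premises-mono B⊆C ds

mutual
  weaken : L ⊆ L′ → Derives B L t → Derives B L′ t
  weaken L⊆L′ (ref l∈L)   = ref (L⊆L′ l∈L)
  weaken L⊆L′ (app₁ r)    = app₁ r
  weaken L⊆L′ (app₂ r ds) = app₂ r (Premises-weaken L⊆L′ ds)
  weaken L⊆L′ (abs d e)   = abs (weaken L⊆L′ d) (weaken L⊆L′ e)
  weaken L⊆L′ (dm d)      = dm (weaken (∷⁺ʳ _ L⊆L′) d)

  Premises-weaken : L ⊆ L′ → Premises B L ps → Premises B L′ ps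
  Premises-weaken L⊆L′ []             = []
  Premises-weaken L⊆L′ (_∷_ {p} d ds) =
    weaken (++⁺ˡ (proj₁ p) L⊆L′) d ∷ Premises-weaken L⊆L′ ds

mutual
  discharge : Derives (B ⊕ m) L t → m ∈ L → Derives B L t
  discharge (ref l∈L)              m∈L = ref l∈L
  discharge (app₁ (inj₁ r))        m∈L = app₁ r
  discharge (app₁ (inj₂ refl))     m∈L = ref m∈L
  discharge (app₂ (inj₁ r) ds)     m∈L = app₂ r (Premises-discharge ds m∈L)
  discharge (app₂ (inj₂ refl) ds)  m∈L = ref m∈L
  discharge (abs d e)              m∈L = abs (discharge d m∈L) (discharge e m∈L)
  discharge (dm d)                 m∈L = dm (discharge d (there m∈L))

  Premises-discharge : Premises (B ⊕ m) L ps → m ∈ L → Premises B L ps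
  Premises-discharge []       m∈L = []
  Premises-discharge (d ∷ ds) m∈L =
    discharge d (xs⊆xs++ys _ _ m∈L) ∷ Premises-discharge ds m∈L

Derives-⊥-elim : ∀ l → Derives B L tbot → Derives B L (tlit l)
Derives-⊥-elim {B} {L} l d =
  subst (λ l′ → Derives B L (tlit l′)) (dual-involutive l) (dm (weaken there d))

-- Under the hypothesis dual l, each of the axioms c⁺ and c⁻ is contradictory,
-- so DM derives both c⁻ and c⁺ from dual l; ABS and DM then give l.
Derives-split : Proves (B ⊕ pos c) l → Proves (B ⊕ neg c) l → Proves B l
Derives-split {B} {c} {l} d₁ d₂ =
  subst (Proves B) (dual-involutive l) (dm (abs (dm (refute d₁)) (dm (refute d₂))))
  where
  refute : ∀ {m} → Proves (B ⊕ m) l → Derives B (m ∷ dual l ∷ []) tbot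
  refute d = abs (discharge (weaken (λ ()) d) (here refl)) (ref (there (here refl)))

Supp-mono : ∀ φ {B C} → B ⊆ᴮ C → Supp B φ → Supp C φ
Supp-mono (lit l)  B⊆C (lift d) = lift (Derives-mono B⊆C d)
Supp-mono bot      B⊆C s l      = lift (Derives-mono B⊆C (lower (s l)))
Supp-mono top      B⊆C s        = tt
Supp-mono (φ ∧ᶠ ψ) B⊆C (s , t)  = Supp-mono φ B⊆C s , Supp-mono ψ B⊆C t
Supp-mono (φ ∨ᶠ ψ) B⊆C s C      = s C ∘ ⊆′-trans B⊆C
Supp-mono (φ ⇒ᶠ ψ) B⊆C s C      = s C ∘ ⊆′-trans B⊆C

Supp-⊥-elim : ∀ φ {B} → Supp B bot → Supp B φ
Supp-⊥-elim (lit l)  s             = s l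
Supp-⊥-elim bot      s             = s
Supp-⊥-elim top      s             = tt
Supp-⊥-elim (φ ∧ᶠ ψ) s             = Supp-⊥-elim φ s , Supp-⊥-elim ψ s
Supp-⊥-elim (φ ∨ᶠ ψ) s C B⊆C l _ _ = Supp-mono bot B⊆C s l
Supp-⊥-elim (φ ⇒ᶠ ψ) s C B⊆C _     = Supp-⊥-elim ψ (Supp-mono bot B⊆C s)

Supp-split : ∀ φ {B c} → Supp (B ⊕ pos c) φ → Supp (B ⊕ neg c) φ → Supp B φ
Supp-split (lit l)  (lift d) (lift e) = lift (Derives-split d e)
Supp-split bot      s t l             = lift (Derives-split (lower (s l)) (lower (t l)))
Supp-split top      s t               = tt
Supp-split (φ ∧ᶠ ψ) (s , s′) (t , t′) = Supp-split φ s t , Supp-split ψ s′ t′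
Supp-split (φ ∨ᶠ ψ) s t C B⊆C l hφ hψ =
  Supp-split (lit l) (s _ (⊕-mono B⊆C) l (restrict hφ) (restrict hψ))
                     (t _ (⊕-mono B⊆C) l (restrict hφ) (restrict hψ))
  where
  restrict : ∀ {χ m} → (∀ D → C ⊆ᴮ D → Supp D χ → Supp D (lit l)) →
             (∀ D → (C ⊕ m) ⊆ᴮ D → Supp D χ → Supp D (lit l))
  restrict h D = h D ∘ ⊆′-trans ⊕-extends
Supp-split (φ ⇒ᶠ ψ) s t C B⊆C x =
  Supp-split ψ {C} (s _ (⊕-mono B⊆C) (Supp-mono φ ⊕-extends x))
                   (t _ (⊕-mono B⊆C) (Supp-mono φ ⊕-extends x))

Decision : Base → Content → Set
Decision D c = Proves D (pos c) ⊎ Proves D (neg c)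

Supp-byCases : ∀ cs φ {B} → (∀ {D} → B ⊆ᴮ D → All (Decision D) cs → Supp D φ) → Supp B φ
Supp-byCases []       φ     h = h ⊆′-refl []
Supp-byCases (c ∷ cs) φ {B} h = Supp-split φ
  (Supp-byCases cs φ {B ⊕ pos c} λ ⊆D ds → h (⊆′-trans ⊕-extends ⊆D) (inj₁ (axiomIn ⊆D) ∷ ds))
  (Supp-byCases cs φ {B ⊕ neg c} λ ⊆D ds → h (⊆′-trans ⊕-extends ⊆D) (inj₂ (axiomIn ⊆D) ∷ ds))
  where
  axiomIn : ∀ {m D} → (B ⊕ m) ⊆ᴮ D → Proves D m
  axiomIn ⊆D = Derives-mono ⊆D ⊕-axiom

atoms : Formula → List Content
atoms (lit l)  = content l ∷ []
atoms bot      = []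
atoms top      = []
atoms (φ ∧ᶠ ψ) = atoms φ ++ atoms ψ
atoms (φ ∨ᶠ ψ) = atoms φ ++ atoms ψ
atoms (φ ⇒ᶠ ψ) = atoms φ ++ atoms ψ

Agrees : Base → Valuation → List Content → Set
Agrees D v cs = ∀ {l} → content l ∈ cs → evalLit v l ≡ true → Proves D l

Agrees-mono : D ⊆ᴮ E → Agrees D v cs → Agrees E v cs
Agrees-mono D⊆E agree c∈cs = Derives-mono D⊆E ∘ agree c∈cs

Agrees-++ˡ : ∀ cs → Agrees D v (cs ++ cs′) → Agrees D v cs
Agrees-++ˡ cs agree = agree ∘ xs⊆xs++ys cs _

Agrees-++ʳ : ∀ cs → Agrees D v (cs ++ cs′) → Agrees D v cs′
Agrees-++ʳ cs agree = agree ∘ xs⊆ys++xs _ cs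

valuation : All (Decision D) cs → Valuation
valuation {cs = cs} ds c with c ∈? cs
... | yes c∈cs = [ (λ _ → true) , (λ _ → false) ]′ (All.lookup ds c∈cs)
... | no _     = false

valuation-agrees : (ds : All (Decision D) cs) → Agrees D (valuation ds) cs
valuation-agrees {cs = cs} ds {pos c} c∈cs holds with c ∈? cs
... | no c∉cs = contradiction c∈cs c∉cs
... | yes c∈cs′ with All.lookup ds c∈cs′ | holds
...   | inj₁ d | _  = d
...   | inj₂ _ | ()
valuation-agrees {cs = cs} ds {neg c} c∈cs holds with c ∈? cs
... | no c∉cs = contradiction c∈cs c∉cs
... | yes c∈cs′ with All.lookup ds c∈cs′ | holds
...   | inj₂ d | _  = d
...   | inj₁ _ | ()

Verdict : Base → Bool → Formula → Set₁
Verdict D true  φ = Supp D φ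
Verdict D false φ = Supp D φ → Supp D bot

Persistent : Base → Bool → Formula → Set₁
Persistent D b φ = ∀ {E} → D ⊆ᴮ E → Verdict E b φ

Supp-⊥-intro : ∀ m → Proves D m → Proves D (dual m) → Supp D bot
Supp-⊥-intro m d e l = lift (Derives-⊥-elim l (abs d e))

lit-verdict : ∀ l → Agrees D v (content l ∷ []) → Verdict D (evalLit v l) (lit l)
lit-verdict {v = v} (pos c) agree with v c in eq
... | true  = lift (agree (here refl) eq)
... | false = λ s → Supp-⊥-intro (pos c) (lower s) (agree (here refl) (cong not eq))
lit-verdict {v = v} (neg c) agree with v c in eq
... | false = lift (agree (here refl) (cong not eq))
... | true  = λ s → Supp-⊥-intro (neg c) (lower s) (agree {pos c} (here refl) eq)

∧-verdict : ∀ a b → Verdict D a φ → Verdict D b ψ → Verdict D (a ∧ b) (φ ∧ᶠ ψ)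
∧-verdict true  true  s t = s , t
∧-verdict true  false s t = t ∘ proj₂
∧-verdict false _     s t = s ∘ proj₁

∨-verdict : ∀ a b → Persistent D a φ → Persistent D b ψ → Verdict D (a ∨ b) (φ ∨ᶠ ψ)
∨-verdict true  _     s _ C D⊆C _ hφ _  = hφ C ⊆′-refl (s D⊆C)
∨-verdict false true  _ t C D⊆C _ _  hψ = hψ C ⊆′-refl (t D⊆C)
∨-verdict false false s t u l =
  u _ ⊆′-refl l (λ _ D⊆E x → s D⊆E x l) (λ _ D⊆E y → t D⊆E y l)

⇒-verdict : ∀ a b → Persistent D a φ → Persistent D b ψ → Verdict D (not a ∨ b) (φ ⇒ᶠ ψ)
⇒-verdict {ψ = ψ} false _ s _ C D⊆C x = Supp-⊥-elim ψ (s D⊆C x)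
⇒-verdict true  true  _ t C D⊆C _ = t D⊆C
⇒-verdict true  false s t u       = t ⊆′-refl (u _ ⊆′-refl (s ⊆′-refl))

kalmar : ∀ φ {D v} → Agrees D v (atoms φ) → Verdict D (eval v φ) φ
kalmar (lit l)      agree = lit-verdict l agree
kalmar bot          agree = id
kalmar top          agree = tt
kalmar (φ ∧ᶠ ψ) {v = v} agree =
  ∧-verdict (eval v φ) (eval v ψ) (kalmar φ (Agrees-++ˡ (atoms φ) agree))
                                  (kalmar ψ (Agrees-++ʳ (atoms φ) agree))
kalmar (φ ∨ᶠ ψ) {v = v} agree =
  ∨-verdict (eval v φ) (eval v ψ)
    (λ D⊆E → kalmar φ (Agrees-mono D⊆E (Agrees-++ˡ (atoms φ) agree)))
    (λ D⊆E → kalmar ψ (Agrees-mono D⊆E (Agrees-++ʳ (atoms φ) agree)))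
kalmar (φ ⇒ᶠ ψ) {v = v} agree =
  ⇒-verdict (eval v φ) (eval v ψ)
    (λ D⊆E → kalmar φ (Agrees-mono D⊆E (Agrees-++ˡ (atoms φ) agree)))
    (λ D⊆E → kalmar ψ (Agrees-mono D⊆E (Agrees-++ʳ (atoms φ) agree)))

satisfies-or-Supp-⊥ : ∀ Γ {D v} → Agrees D v (concatMap atoms Γ) → All (Supp D) Γ →
                      All (λ γ → eval v γ ≡ true) Γ ⊎ Supp D bot
satisfies-or-Supp-⊥ []      agree []       = inj₁ []
satisfies-or-Supp-⊥ (γ ∷ Γ) {v = v} agree (s ∷ ss)
  with eval v γ in eq | kalmar γ (Agrees-++ˡ (atoms γ) agree)
... | false | refute = inj₂ (refute s)
... | true  | _      =
  Sum.map₁ (eq ∷_) (satisfies-or-Supp-⊥ Γ (Agrees-++ʳ (atoms γ) agree) ss)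

Supp-consequence : ∀ Γ φ → Γ ⊢ φ → All (Supp B) Γ → Supp B φ
Supp-consequence Γ φ Γ⊢φ sΓ = Supp-byCases (atoms φ ++ concatMap atoms Γ) φ λ {D} B⊆D ds →
  let agree = valuation-agrees ds
      sΓ′   = All.map (λ {γ} → Supp-mono γ B⊆D) sΓ
  in case satisfies-or-Supp-⊥ Γ (Agrees-++ʳ (atoms φ) agree) sΓ′ of λ where
    (inj₁ sat) → subst (λ b → Verdict D b φ) (Γ⊢φ (valuation ds) sat)
                       (kalmar φ (Agrees-++ˡ (atoms φ) agree))
    (inj₂ s⊥)  → Supp-⊥-elim φ s⊥

mainTheorem6 : (Γ : List Formula) (φ : Formula) → Γ ⊢ φ → Γ ⊩ φ
mainTheorem6 []        φ Γ⊢φ _        = Supp-consequence [] φ Γ⊢φ []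
mainTheorem6 Γ@(_ ∷ _) φ Γ⊢φ _ _ _ sΓ = Supp-consequence Γ φ Γ⊢φ sΓ
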